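{- For all positive integers $k,n$, $d(k,n)\ge \binom{n-1}{k}$.
   Context: For a finite set $A$ of positive integers, write $\sum A$ for the sum of its elements. A subset $B\subseteq A$ is a divisor of $A$ if $\sum B$ divides $\sum A$. $d_k(A)$ is the number of $k$-element subsets of $A$ that are divisors of $A$, and $d(k,n)$ is the maximum of $d_k(A)$ over all sets $A$ of $n$ positive integers. -}

module Defs where

open import Data.Nat using (ℕ; zero; suc; _+_; _<_)
open import Data.Nat.Divisibility using (_∣_; _∣?_)
open import Data.Bool using (Bool; true; false)
open import Data.Fin using (Fin)
open import Data.Fin.Subset using (Subset; ∣_∣)
open import Data.Vec using (Vec; []; _∷_; lookup)
open import Data.List using (List; length; filter; map; _++_) renaming ([] to []ₗ; _∷_ to _∷ₗ_)
open import Data.Product using (_×_)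
open import Relation.Nullary.Decidable using (_×-dec_)
open import Relation.Binary.PropositionalEquality using (_≡_)
import Data.Nat as N

-- A finite set of n positive integers is represented by a vector of
-- n pairwise distinct positive naturals (its enumeration).
IsPosSet : {n : ℕ} → Vec ℕ n → Set
IsPosSet {n} A = ((i : Fin n) → 0 < lookup A i) ×
                 ((i j : Fin n) → lookup A i ≡ lookup A j → i ≡ j)

total : {n : ℕ} → Vec ℕ n → ℕ
total [] = 0
total (x ∷ xs) = x + total xs

subsetSum : {n : ℕ} → Vec ℕ n → Subset n → ℕ
subsetSum [] [] = 0
subsetSum (x ∷ xs) (true ∷ s) = x + subsetSum xs s
subsetSum (x ∷ xs) (false ∷ s) = subsetSum xs s

IsDivisor : {n : ℕ} → Vec ℕ n → Subset n → Set
IsDivisor A B = subsetSum A B ∣ total A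

allSubsets : (n : ℕ) → List (Subset n)
allSubsets zero = [] ∷ₗ []ₗ
allSubsets (suc n) = map (true ∷_) (allSubsets n) ++ map (false ∷_) (allSubsets n)

dk : {n : ℕ} → ℕ → Vec ℕ n → ℕ
dk {n} k A = length (filter (λ B → (∣ B ∣ N.≟ k) ×-dec (subsetSum A B ∣? total A)) (allSubsets n))

-- Take A = {x} ∪ R where R is any set of n - 1 positive integers with sum S, and
-- x = (2S + 1)·S! - S. Then ΣA = (2S + 1)·S!, and every nonempty subset of R has
-- a sum s with 1 ≤ s ≤ S, so s ∣ S! ∣ ΣA. Hence all C(n-1, k) k-subsets of R
-- are divisors of A, and x > S guarantees that x is a new element.
module Submission where

open import Defs
open import Data.Nat using (ℕ; _≤_; _∸_)
open import Data.Nat.Combinatorics using (_C_)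
open import Data.Vec using (Vec)
open import Data.Product using (Σ; _×_)

open import Data.Nat using (zero; suc; _+_; _*_; _<_; z≤n; s≤s; _!; _≟_)
open import Data.Nat.Properties
open import Data.Nat.Divisibility using (_∣_; _∣?_; ∣-trans; m∣m*n; n∣m*n; m≤n⇒m!∣n!)
open import Data.Nat.Combinatorics using (nCk+nC[k+1]≡[n+1]C[k+1])
open import Data.Bool using (true; false)
open import Data.Fin using () renaming (zero to fzero; suc to fsuc)
open import Data.Fin.Subset using (Subset; ∣_∣)
open import Data.Vec using ([]; _∷_; lookup)
open import Data.List using (List; length; filter; map; _++_) renaming ([] to []ₗ; _∷_ to _∷ₗ_)
open import Data.List.Properties using (length-++; filter-++; filter-none; filter-≐)
open import Data.List.Relation.Binary.Sublist.Propositional using (⊆-refl)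
open import Data.List.Relation.Binary.Sublist.Propositional.Properties using (filter⁺; ++⁺ˡ; length-mono-≤)
open import Data.List.Relation.Unary.All using (universal)
open import Data.Product using (_,_)
open import Data.Empty using (⊥-elim)
open import Relation.Nullary using (does)
open import Relation.Nullary.Decidable using (_×-dec_)
open import Relation.Unary using (Pred; Decidable)
open import Relation.Binary.PropositionalEquality
open import Function using (_∘_)

length-filter-map : ∀ {a b p} {A : Set a} {B : Set b} {P : Pred B p} (P? : Decidable P)
  (f : A → B) (xs : List A) → length (filter P? (map f xs)) ≡ length (filter (P? ∘ f) xs)
length-filter-map P? f []ₗ = refl
length-filter-map P? f (x ∷ₗ xs) with does (P? (f x))
... | true  = cong suc (length-filter-map P? f xs)
... | false = length-filter-map P? f xs

hasSize? : ∀ {m} (k : ℕ) → Decidable (λ (B : Subset m) → ∣ B ∣ ≡ k)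
hasSize? k B = ∣ B ∣ ≟ k

#subsets-of-size : ∀ m k → length (filter (hasSize? k) (allSubsets m)) ≡ m C k
#subsets-of-size zero zero    = refl
#subsets-of-size zero (suc k) = refl
#subsets-of-size (suc m) k = begin
  length (filter (hasSize? k) (map (true ∷_) S ++ map (false ∷_) S))
    ≡⟨ cong length (filter-++ (hasSize? k) (map (true ∷_) S) (map (false ∷_) S)) ⟩
  length (filter (hasSize? k) (map (true ∷_) S) ++ filter (hasSize? k) (map (false ∷_) S))
    ≡⟨ length-++ (filter (hasSize? k) (map (true ∷_) S)) ⟩
  length (filter (hasSize? k) (map (true ∷_) S)) + length (filter (hasSize? k) (map (false ∷_) S))
    ≡⟨ cong₂ _+_ (length-filter-map (hasSize? k) (true ∷_) S)
                 (trans (length-filter-map (hasSize? k) (false ∷_) S) (#subsets-of-size m k)) ⟩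
  length (filter (hasSize? k ∘ (true ∷_)) S) + m C k
    ≡⟨ pascal k ⟩
  suc m C k ∎
  where
  open ≡-Reasoning
  S = allSubsets m
  pascal : ∀ k → length (filter (hasSize? k ∘ (true ∷_)) S) + m C k ≡ suc m C k
  pascal zero = cong (λ l → length l + m C 0) (filter-none (hasSize? 0 ∘ (true ∷_)) (universal (λ _ ()) S))
  pascal (suc j) = begin
    length (filter (hasSize? (suc j) ∘ (true ∷_)) S) + m C suc j
      ≡⟨ cong (λ l → length l + m C suc j) (filter-≐ _ (hasSize? j) (suc-injective , cong suc) S) ⟩
    length (filter (hasSize? j) S) + m C suc j
      ≡⟨ cong (_+ m C suc j) (#subsets-of-size m j) ⟩
    m C j + m C suc j
      ≡⟨ nCk+nC[k+1]≡[n+1]C[k+1] m j ⟩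
    suc m C suc j ∎

C≤dk-∷ : ∀ {m} k x (A : Vec ℕ m) → (∀ B → ∣ B ∣ ≡ k → subsetSum A B ∣ total (x ∷ A)) →
  m C k ≤ dk k (x ∷ A)
C≤dk-∷ {m} k x A divides = begin
  m C k
    ≡⟨ #subsets-of-size m k ⟨
  length (filter (hasSize? k) S)
    ≤⟨ length-mono-≤ (filter⁺ (hasSize? k) (Q? ∘ (false ∷_)) (λ { refl e → e , divides _ e }) (⊆-refl {x = S})) ⟩
  length (filter (Q? ∘ (false ∷_)) S)
    ≡⟨ length-filter-map Q? (false ∷_) S ⟨
  length (filter Q? (map (false ∷_) S))
    ≤⟨ length-mono-≤ (filter⁺ Q? Q? (λ { refl q → q }) (++⁺ˡ (map (true ∷_) S) ⊆-refl)) ⟩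
  dk k (x ∷ A) ∎
  where
  open ≤-Reasoning
  S = allSubsets m
  Q? : Decidable (λ B → ∣ B ∣ ≡ k × IsDivisor (x ∷ A) B)
  Q? B = (∣ B ∣ ≟ k) ×-dec (subsetSum (x ∷ A) B ∣? total (x ∷ A))

subsetSum≤total : ∀ {m} (A : Vec ℕ m) (B : Subset m) → subsetSum A B ≤ total A
subsetSum≤total []      []          = z≤n
subsetSum≤total (x ∷ A) (true ∷ B)  = +-monoʳ-≤ x (subsetSum≤total A B)
subsetSum≤total (x ∷ A) (false ∷ B) = ≤-trans (subsetSum≤total A B) (m≤n+m (total A) x)

subsetSum-pos : ∀ {m} (A : Vec ℕ m) (B : Subset m) → (∀ i → 0 < lookup A i) → 0 < ∣ B ∣ →
  0 < subsetSum A B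
subsetSum-pos (x ∷ A) (true ∷ B)  pos _     = <-≤-trans (pos fzero) (m≤m+n x _)
subsetSum-pos (x ∷ A) (false ∷ B) pos 0<∣B∣ = subsetSum-pos A B (pos ∘ fsuc) 0<∣B∣

lookup≤total : ∀ {m} (A : Vec ℕ m) i → lookup A i ≤ total A
lookup≤total (x ∷ A) fzero    = m≤m+n x (total A)
lookup≤total (x ∷ A) (fsuc i) = ≤-trans (lookup≤total A i) (m≤n+m (total A) x)

IsPosSet-[] : IsPosSet []
IsPosSet-[] = (λ ()) , (λ ())

IsPosSet-∷ : ∀ {m x} {A : Vec ℕ m} → 0 < x → (∀ i → lookup A i < x) → IsPosSet A → IsPosSet (x ∷ A)
IsPosSet-∷ {x = x} {A} 0<x A<x (pos , inj) = pos′ , inj′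
  where
  pos′ : ∀ i → 0 < lookup (x ∷ A) i
  pos′ fzero    = 0<x
  pos′ (fsuc i) = pos i
  inj′ : ∀ i j → lookup (x ∷ A) i ≡ lookup (x ∷ A) j → i ≡ j
  inj′ fzero    fzero    _  = refl
  inj′ fzero    (fsuc j) eq = ⊥-elim (<-irrefl (sym eq) (A<x j))
  inj′ (fsuc i) fzero    eq = ⊥-elim (<-irrefl eq (A<x i))
  inj′ (fsuc i) (fsuc j) eq = cong fsuc (inj i j eq)

countdown : (m : ℕ) → Vec ℕ m
countdown zero    = []
countdown (suc m) = suc m ∷ countdown m

lookup-countdown≤ : ∀ m i → lookup (countdown m) i ≤ m
lookup-countdown≤ (suc m) fzero    = ≤-refl
lookup-countdown≤ (suc m) (fsuc i) = m≤n⇒m≤1+n (lookup-countdown≤ m i)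

IsPosSet-countdown : ∀ m → IsPosSet (countdown m)
IsPosSet-countdown zero    = IsPosSet-[]
IsPosSet-countdown (suc m) =
  IsPosSet-∷ (s≤s z≤n) (s≤s ∘ lookup-countdown≤ m) (IsPosSet-countdown m)

0<m≤n⇒m∣n! : ∀ {m n} → 0 < m → m ≤ n → m ∣ n !
0<m≤n⇒m∣n! {suc m} _ m≤n = ∣-trans (m∣m*n (m !)) (m≤n⇒m!∣n! m≤n)

extend-to-divisible : ∀ {m} (A : Vec ℕ m) → IsPosSet A →
  Σ ℕ λ x → IsPosSet (x ∷ A) × (∀ B → 0 < ∣ B ∣ → subsetSum A B ∣ total (x ∷ A))
extend-to-divisible A isPosSet@(pos , _) = T ∸ S , IsPosSet-∷ 0<x A<x isPosSet , divides
  where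
  S = total A
  T = suc (S + S) * S !
  S<x : S < T ∸ S
  S<x = m+n≤o⇒m≤o∸n (suc S) (m≤m*n (suc (S + S)) (S !) {{S !≢0}})
  0<x : 0 < T ∸ S
  0<x = ≤-<-trans z≤n S<x
  A<x : ∀ i → lookup A i < T ∸ S
  A<x i = ≤-<-trans (lookup≤total A i) S<x
  total≡T : total (T ∸ S ∷ A) ≡ T
  total≡T = m∸n+n≡m (≤-trans (<⇒≤ S<x) (m∸n≤m T S))
  divides : ∀ B → 0 < ∣ B ∣ → subsetSum A B ∣ total (T ∸ S ∷ A)
  divides B 0<∣B∣ rewrite total≡T =
    ∣-trans (0<m≤n⇒m∣n! (subsetSum-pos A B pos 0<∣B∣) (subsetSum≤total A B)) (n∣m*n (suc (S + S)))

mainTheorem5 : (k n : ℕ) → 1 ≤ k → 1 ≤ n →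
    Σ (Vec ℕ n) (λ A → IsPosSet A × ((n ∸ 1) C k) ≤ dk k A)
mainTheorem5 k (suc m) 1≤k _ with extend-to-divisible (countdown m) (IsPosSet-countdown m)
... | x , isPosSet , divides = x ∷ countdown m , isPosSet ,
  C≤dk-∷ k x (countdown m) (λ B ∣B∣≡k → divides B (subst (0 <_) (sym ∣B∣≡k) 1≤k))
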